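{- Let $n \geq 1$ and let $G$ be the \textsc{Myopic Col} position on a directed path $u_1 \to u_2 \to \cdots \to u_n$ of $n$ uncolored vertices, optionally followed by one further colored vertex $v$ with an arc $u_n \to v$ (and no other vertices or arcs). Then $G = n \times *$ if there is no $v$; $G = (n-1) \times * - 1$ if $v$ is blue; $G = (n-1) \times * + 1$ if $v$ is red.
   Context: \textsc{Myopic Col} is a partizan combinatorial game under normal play (a player unable to move loses). A position is a directed graph $(V,E)$ together with a coloring $c : V \to \{\text{uncolored}, \text{red}, \text{blue}\}$. On a turn, a player of color $A \in \{\text{red}, \text{blue}\}$ chooses a vertex $v$ with $c(v) = \text{uncolored}$ such that there is no arc $(v, b) \in E$ with $c(b) = A$ (only out-neighbours of $v$ matter), and recolors $v$ with $A$; the graph is unchanged. Blue is the Left player and Red is the Right player. Values are standard combinatorial game values (sums of games, integers, nimbers); $*=\{0\mid 0\}$ and $m \times *$ denotes the sum of $m$ copies of $*$ (equal to $*$ if $m$ is odd and $0$ if $m$ is even). -}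

module Defs where

open import Data.Nat using (ℕ; zero; suc; _+_; _∸_)
open import Data.Fin using (Fin; toℕ; fromℕ)
open import Data.Fin.Properties using (_≟_)
open import Data.Bool using (Bool; true; false; _∧_; not; if_then_else_)
open import Data.List using (List; []; _∷_; length; lookup; map)
open import Data.Bool.ListAction using (and)
open import Data.List.Base using (filterᵇ)
open import Data.List.Base using (allFin)
open import Data.Product using (_×_)
open import Data.Vec.Functional using () renaming (_++_ to _⧺_)
open import Relation.Nullary using (¬_; does)
open import Relation.Binary.PropositionalEquality using (_≡_)
import Data.Nat as ℕ

data Game : Set where
  mk : (nL : ℕ) → (Fin nL → Game) → (nR : ℕ) → (Fin nR → Game) → Game

infix 4 _≤G_ _≈G_
_≤G_ : Game → Game → Set
mk nl L nr R ≤G mk ml L' mr R' =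
  ((i : Fin nl) → ¬ (mk ml L' mr R' ≤G L i)) ×
  ((j : Fin mr) → ¬ (R' j ≤G mk nl L nr R))

_≈G_ : Game → Game → Set
G ≈G H = (G ≤G H) × (H ≤G G)

infixl 6 _+G_
_+G_ : Game → Game → Game
mk nl L nr R +G mk ml L' mr R' =
  mk (nl + ml) ((λ i → L i +G mk ml L' mr R') ⧺ (λ i → mk nl L nr R +G L' i))
     (nr + mr) ((λ j → R j +G mk ml L' mr R') ⧺ (λ j → mk nl L nr R +G R' j))

-G_ : Game → Game
-G mk nl L nr R = mk nr (λ j → -G R j) nl (λ i → -G L i)

0G : Game
0G = mk 0 (λ ()) 0 (λ ())

1G : Game
1G = mk 1 (λ _ → 0G) 0 (λ ())

⋆G : Game
⋆G = mk 1 (λ _ → 0G) 1 (λ _ → 0G)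

_×G_ : ℕ → Game → Game
zero  ×G G = 0G
suc m ×G G = G +G (m ×G G)

data Colour : Set where
  uncoloured red blue : Colour

data Player : Set where
  Blue Red : Player   -- Blue = Left, Red = Right

colourOf : Player → Colour
colourOf Blue = blue
colourOf Red  = red

isUncoloured : Colour → Bool
isUncoloured uncoloured = true
isUncoloured _          = false

isColour : Player → Colour → Bool
isColour Blue blue = true
isColour Red  red  = true
isColour _    _    = false

-- A position: a digraph on vertex set Fin k, with arc relation
-- (arc a b = true iff (a , b) ∈ E), and a colouring.
record Position : Set where
  constructor pos
  field
    k      : ℕ
    arc    : Fin k → Fin k → Bool
    colour : Fin k → Colour

legal : {k : ℕ} → (Fin k → Fin k → Bool) → (Fin k → Colour) → Player → Fin k → Bool
legal arc c A v =
  isUncoloured (c v) ∧ and (map (λ b → not (arc v b ∧ isColour A (c b))) (allFin _))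

moves : {k : ℕ} → (Fin k → Fin k → Bool) → (Fin k → Colour) → Player → List (Fin k)
moves arc c A = filterᵇ (legal arc c A) (allFin _)

recolour : {k : ℕ} → (Fin k → Colour) → Fin k → Colour → Fin k → Colour
recolour c v x w = if does (w ≟ v) then x else c w

countUncoloured : {k : ℕ} → (Fin k → Colour) → ℕ
countUncoloured c = length (filterᵇ (λ v → isUncoloured (c v)) (allFin _))

-- Game tree, by recursion on a fuel parameter; used with fuel equal to
-- the number of uncoloured vertices (each move colours exactly one
-- uncoloured vertex, so this fuel is exact).
colGame' : {k : ℕ} → ℕ → (Fin k → Fin k → Bool) → (Fin k → Colour) → Game
colGame' zero    arc c = 0G
colGame' (suc f) arc c =
  mk (length (moves arc c Blue))
     (λ i → colGame' f arc (recolour c (lookup (moves arc c Blue) i) blue))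
     (length (moves arc c Red))
     (λ j → colGame' f arc (recolour c (lookup (moves arc c Red) j) red))

colGame : Position → Game
colGame (pos k arc c) = colGame' (countUncoloured c) arc c

-- The directed path u₁ → ⋯ → uₙ (vertices 0 … n-1), all uncoloured.
pathArc : (k : ℕ) → Fin k → Fin k → Bool
pathArc k a b = does (toℕ b ℕ.≟ suc (toℕ a))

pathPos : ℕ → Position
pathPos n = pos n (pathArc n) (λ _ → uncoloured)

-- The path u₁ → ⋯ → uₙ → v, where v (vertex n) is coloured by player A's
-- colour and u₁ … uₙ (vertices 0 … n-1) are uncoloured.
pathPlusPos : ℕ → Player → Position
pathPlusPos n A =
  pos (suc n) (pathArc (suc n))
      (λ w → if does (w ≟ fromℕ n) then colourOf A else uncoloured)

-- Every uncoloured vertex of a directed path behaves like a separate component whose value depends only on the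
-- colour of its successor: ⋆ when the successor is uncoloured or absent (both players may colour the vertex),
-- -1 when it is blue (only Red may) and +1 when it is red (only Blue may). So every position on a path, not just
-- the three of the theorem, equals the sum of these contributions, a value of the form a + e⋆. This is checked
-- through the simplicity conditions for such a value x: colouring a vertex changes the sum only by its own
-- contribution and by that of its uncoloured predecessor, which never leaves a move at least as good as x for the
-- mover, while there is always a move reaching the canonical option of x (by removing a ⋆ or moving the integer
-- part one step).

module Submission where

open import Defs
open import Algebra.Bundles using (AbelianGroup; CommutativeMonoid)
import Algebra.Properties.Group as GroupProperties
import Algebra.Solver.CommutativeMonoid as MonoidSolver
open import Data.Bool using (Bool; true; false; _xor_; not; T; _∧_; if_then_else_)
open import Data.Bool.Properties using (xor-assoc; xor-comm; not-involutive; T-∧; T-≡; ∧-identityʳ)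
open import Data.Bool.ListAction using (and)
open import Data.Empty using (⊥-elim)
open import Data.Fin as Fin using (Fin; zero; suc; toℕ; splitAt; _↑ˡ_; _↑ʳ_)
import Data.Fin.Properties as Fin
open import Data.Integer as ℤ using (ℤ; +_; -[1+_]; -_)
import Data.Integer.Properties as ℤ
open import Data.Integer.Solver using (module +-*-Solver)
open import Data.List using ([]; _∷_; length; lookup; filterᵇ; tabulate; allFin)
open import Data.List.Membership.Propositional using (_∈_; lose)
open import Data.List.Membership.Propositional.Properties using (∈-allFin; ∈-filter⁺; ∈-filter⁻; ∈-lookup)
open import Data.List.Properties using (map-tabulate; filter-some)
open import Data.List.Relation.Unary.Any using (here; there; index)
open import Data.List.Relation.Unary.Any.Properties using (lookup-index)
open import Data.Nat as ℕ using (ℕ; _≤_; _<_; _∸_; z≤n; s≤s)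
import Data.Nat.Properties as ℕ
open import Data.Product using (Σ; _×_; _,_; proj₁; proj₂)
open import Data.Sum using (_⊎_; inj₁; inj₂; [_,_]′)
open import Data.Unit using (tt)
open import Data.Vec using ([]; _∷_)
open import Data.Vec.Functional using () renaming (_++_ to _⧺_)
open import Data.Vec.Functional.Properties using (lookup-++ˡ; lookup-++ʳ)
open import Function using (_∘_; id; Equivalence)
open import Relation.Binary.PropositionalEquality
open import Relation.Nullary using (¬_; Dec; yes; no; does)
open import Relation.Nullary.Decidable using (T?; dec-true)
import Relation.Nullary.Decidable as Dec

open ≡-Reasoning

-- Values a + e⋆

data Val : Set where
  _+⋆_ : ℤ → Bool → Val

int : Val → ℤ
int (a +⋆ _) = a

star : Val → Bool
star (_ +⋆ e) = e

infix  4 _+⋆_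
infixl 6 _+ᵛ_
infix  3 _≤ᵛ_ _≤ᵛ?_

0ᵛ ⋆ᵛ : Val
0ᵛ = + 0 +⋆ false
⋆ᵛ = + 0 +⋆ true

_+ᵛ_ : Val → Val → Val
(a +⋆ e) +ᵛ (b +⋆ d) = a ℤ.+ b +⋆ e xor d

_×ᵛ_ : ℕ → Val → Val
ℕ.zero  ×ᵛ x = 0ᵛ
ℕ.suc m ×ᵛ x = x +ᵛ m ×ᵛ x

+ᵛ-assoc : ∀ x y z → (x +ᵛ y) +ᵛ z ≡ x +ᵛ (y +ᵛ z)
+ᵛ-assoc (a +⋆ e) (b +⋆ d) (c +⋆ f) =
  cong₂ _+⋆_ (ℤ.+-assoc a b c) (xor-assoc e d f)

+ᵛ-comm : ∀ x y → x +ᵛ y ≡ y +ᵛ x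
+ᵛ-comm (a +⋆ e) (b +⋆ d) = cong₂ _+⋆_ (ℤ.+-comm a b) (xor-comm e d)

+ᵛ-identityˡ : ∀ x → 0ᵛ +ᵛ x ≡ x
+ᵛ-identityˡ (a +⋆ e) = cong (_+⋆ e) (ℤ.+-identityˡ a)

+ᵛ-identityʳ : ∀ x → x +ᵛ 0ᵛ ≡ x
+ᵛ-identityʳ x = trans (+ᵛ-comm x 0ᵛ) (+ᵛ-identityˡ x)

+ᵛ-0ᵛ-commutativeMonoid : CommutativeMonoid _ _
+ᵛ-0ᵛ-commutativeMonoid = record
  { isCommutativeMonoid = record
    { isMonoid = record
      { isSemigroup = record { isMagma = isMagma _+ᵛ_ ; assoc = +ᵛ-assoc }
      ; identity    = +ᵛ-identityˡ , +ᵛ-identityʳ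
      }
    ; comm = +ᵛ-comm
    }
  }

int-+ᵛ : ∀ x y → int (x +ᵛ y) ≡ int x ℤ.+ int y
int-+ᵛ (a +⋆ _) (b +⋆ _) = refl

star-+ᵛ : ∀ x y → star (x +ᵛ y) ≡ star x xor star y
star-+ᵛ (_ +⋆ e) (_ +⋆ d) = refl

Below : Bool → ℤ → ℤ → Set
Below false = ℤ._≤_
Below true  = ℤ._<_

-- The order of games on values a + e⋆: a + ⋆ is confused with a, so the comparison of integer parts is strict
-- exactly when one side carries a ⋆.
data _≤ᵛ_ : Val → Val → Set where
  below : ∀ {a e b d} → Below (e xor d) a b → a +⋆ e ≤ᵛ b +⋆ d

Below? : ∀ s a b → Dec (Below s a b)
Below? false = ℤ._≤?_
Below? true  = ℤ._<?_

_≤ᵛ?_ : ∀ x y → Dec (x ≤ᵛ y)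
(a +⋆ e) ≤ᵛ? (b +⋆ d) = Dec.map′ below (λ { (below p) → p }) (Below? (e xor d) a b)

≤ᵛ-refl : ∀ {x} → x ≤ᵛ x
≤ᵛ-refl {a +⋆ false} = below ℤ.≤-refl
≤ᵛ-refl {a +⋆ true}  = below ℤ.≤-refl

Below-trans : ∀ s t {a b c} → Below s a b → Below t b c → Below (s xor t) a c
Below-trans false false = ℤ.≤-trans
Below-trans false true  = ℤ.≤-<-trans
Below-trans true  false = ℤ.<-≤-trans
Below-trans true  true  = λ p q → ℤ.<⇒≤ (ℤ.<-trans p q)

xor-middle : ∀ a b c → (a xor b) xor (b xor c) ≡ a xor c
xor-middle false false c = refl
xor-middle false true  c = not-involutive c
xor-middle true  false c = refl
xor-middle true  true  c = refl

xor-cancelʳ : ∀ a b c → (a xor c) xor (b xor c) ≡ a xor b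
xor-cancelʳ a b c = trans (cong ((a xor c) xor_) (xor-comm b c)) (xor-middle a c b)

≤ᵛ-trans : ∀ {x y z} → x ≤ᵛ y → y ≤ᵛ z → x ≤ᵛ z
≤ᵛ-trans {_ +⋆ e} {_ +⋆ d} {_ +⋆ f} (below p) (below q) =
  below (subst (λ s → Below s _ _) (xor-middle e d f) (Below-trans (e xor d) (d xor f) p q))

Below-+ʳ : ∀ s k {a b} → Below s a b → Below s (a ℤ.+ k) (b ℤ.+ k)
Below-+ʳ false k = ℤ.+-monoˡ-≤ k
Below-+ʳ true  k = ℤ.+-monoˡ-< k

Below-cancelʳ : ∀ s k {a b} → Below s (a ℤ.+ k) (b ℤ.+ k) → Below s a b
Below-cancelʳ s k {a} {b} p =
  subst₂ (Below s) (//-rightDividesʳ k a) (//-rightDividesʳ k b) (Below-+ʳ s (- k) p)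
  where open GroupProperties (AbelianGroup.group ℤ.+-0-abelianGroup)

≤ᵛ-+ʳ : ∀ {x y} z → x ≤ᵛ y → x +ᵛ z ≤ᵛ y +ᵛ z
≤ᵛ-+ʳ {_ +⋆ e} {_ +⋆ d} (k +⋆ f) (below p) =
  below (subst (λ s → Below s _ _) (sym (xor-cancelʳ e d f)) (Below-+ʳ (e xor d) k p))

≤ᵛ-cancelʳ : ∀ {x y} z → x +ᵛ z ≤ᵛ y +ᵛ z → x ≤ᵛ y
≤ᵛ-cancelʳ {_ +⋆ e} {_ +⋆ d} (k +⋆ f) (below p) =
  below (Below-cancelʳ (e xor d) k (subst (λ s → Below s _ _) (xor-cancelʳ e d f) p))

≤ᵛ-+ˡ : ∀ {x y} z → x ≤ᵛ y → z +ᵛ x ≤ᵛ z +ᵛ y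
≤ᵛ-+ˡ {x} {y} z p = subst₂ _≤ᵛ_ (+ᵛ-comm x z) (+ᵛ-comm y z) (≤ᵛ-+ʳ z p)

infix 3 _≤[_]_

-- x ≤[ A ] y : y is at least as good as x for player A.
_≤[_]_ : Val → Player → Val → Set
x ≤[ Blue ] y = x ≤ᵛ y
x ≤[ Red ]  y = y ≤ᵛ x

≤[]-refl : ∀ A {x} → x ≤[ A ] x
≤[]-refl Blue = ≤ᵛ-refl
≤[]-refl Red  = ≤ᵛ-refl

≤[]-reflexive : ∀ A {x y} → x ≡ y → x ≤[ A ] y
≤[]-reflexive A refl = ≤[]-refl A

≤[]-trans : ∀ A {x y z} → x ≤[ A ] y → y ≤[ A ] z → x ≤[ A ] z
≤[]-trans Blue p q = ≤ᵛ-trans p q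
≤[]-trans Red  p q = ≤ᵛ-trans q p

≤[]-+ʳ : ∀ A {x y} z → x ≤[ A ] y → x +ᵛ z ≤[ A ] y +ᵛ z
≤[]-+ʳ Blue z = ≤ᵛ-+ʳ z
≤[]-+ʳ Red  z = ≤ᵛ-+ʳ z

≤[]-+ˡ : ∀ A {x y} z → x ≤[ A ] y → z +ᵛ x ≤[ A ] z +ᵛ y
≤[]-+ˡ Blue z = ≤ᵛ-+ˡ z
≤[]-+ˡ Red  z = ≤ᵛ-+ˡ z

≤[]-cancelʳ : ∀ A {x y} z → x +ᵛ z ≤[ A ] y +ᵛ z → x ≤[ A ] y
≤[]-cancelʳ Blue z = ≤ᵛ-cancelʳ z
≤[]-cancelʳ Red  z = ≤ᵛ-cancelʳ z

≤[]-cancelˡ : ∀ A {x y} z → z +ᵛ x ≤[ A ] z +ᵛ y → x ≤[ A ] y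
≤[]-cancelˡ A {x} {y} z p = ≤[]-cancelʳ A z (subst₂ (_≤[ A ]_) (+ᵛ-comm z x) (+ᵛ-comm z y) p)

≤[]-shift-worse : ∀ A {x x′ K M} → x′ +ᵛ K ≡ x +ᵛ M → ¬ (K ≤[ A ] M) → ¬ (x ≤[ A ] x′)
≤[]-shift-worse A {x} {K = K} eq K≰M x≤x′ =
  K≰M (≤[]-cancelˡ A x (subst (x +ᵛ K ≤[ A ]_) eq (≤[]-+ʳ A K x≤x′)))

≤[]-shift-better : ∀ A {x x′ K M t} → x′ +ᵛ K ≡ x +ᵛ M → t +ᵛ K ≤[ A ] M → x +ᵛ t ≤[ A ] x′
≤[]-shift-better A {x} {x′} {K} {M} {t} eq tK≤M =
  ≤[]-cancelʳ A K (subst₂ (_≤[ A ]_) (sym (+ᵛ-assoc x t K)) (sym eq) (≤[]-+ˡ A x tK≤M))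

Favours : Player → ℤ → Set
Favours Blue a = + 0 ℤ.< a
Favours Red  a = a ℤ.< + 0

Favours? : ∀ A a → Dec (Favours A a)
Favours? Blue a = + 0 ℤ.<? a
Favours? Red  a = a ℤ.<? + 0

favours-+ : ∀ A a b → Favours A (a ℤ.+ b) → Favours A a ⊎ Favours A b
favours-+ A a b h with Favours? A a | Favours? A b
... | yes fa | _      = inj₁ fa
... | no  _  | yes fb = inj₂ fb
... | no ¬fa | no ¬fb = ⊥-elim (¬favours A ¬fa ¬fb h)
  where
  ¬favours : ∀ A → ¬ Favours A a → ¬ Favours A b → ¬ Favours A (a ℤ.+ b)
  ¬favours Blue ¬fa ¬fb = ℤ.≤⇒≯ (ℤ.+-mono-≤ (ℤ.≮⇒≥ ¬fa) (ℤ.≮⇒≥ ¬fb))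
  ¬favours Red  ¬fa ¬fb = ℤ.≤⇒≯ (ℤ.+-mono-≤ (ℤ.≮⇒≥ ¬fa) (ℤ.≮⇒≥ ¬fb))

HasOption : Player → Val → Set
HasOption A x = T (star x) ⊎ Favours A (int x)

-- The canonical A-option of a + e⋆: a ⋆ is removed, otherwise the integer moves one step towards zero
-- (a + ⋆ = {a | a}, and a = {a - 1 | } for a > 0, a = { | a + 1} for a < 0).
option : Player → Val → Val
option A    (a +⋆ true)  = a +⋆ false
option Blue (a +⋆ false) = ℤ.pred a +⋆ false
option Red  (a +⋆ false) = ℤ.suc a +⋆ false

≰ᵛ-option : ∀ x y → ¬ (x ≤ᵛ y) →
  (HasOption Blue x × y ≤ᵛ option Blue x) ⊎ (HasOption Red y × option Red y ≤ᵛ x)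
≰ᵛ-option (a +⋆ true)  (b +⋆ true)  x≰y = inj₁ (inj₁ tt , below (ℤ.≰⇒> (x≰y ∘ below)))
≰ᵛ-option (a +⋆ true)  (b +⋆ false) x≰y = inj₁ (inj₁ tt , below (ℤ.≮⇒≥ (x≰y ∘ below)))
≰ᵛ-option (a +⋆ false) (b +⋆ true)  x≰y = inj₂ (inj₁ tt , below (ℤ.≮⇒≥ (x≰y ∘ below)))
≰ᵛ-option (a +⋆ false) (b +⋆ false) x≰y with ℤ.≰⇒> (x≰y ∘ below) | + 0 ℤ.<? a
... | b<a | yes 0<a = inj₁ (inj₂ 0<a , below (ℤ.i<j⇒i≤pred[j] b<a))
... | b<a | no  0≮a = inj₂ (inj₂ (ℤ.<-≤-trans b<a (ℤ.≮⇒≥ 0≮a)) , below (ℤ.i<j⇒suc[i]≤j b<a))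

option-+ᵛˡ : ∀ A a b → option A (a ℤ.+ b +⋆ false) ≡ option A (a +⋆ false) +ᵛ (b +⋆ false)
option-+ᵛˡ Blue a b = cong (_+⋆ false) (sym (ℤ.pred-+ a b))
option-+ᵛˡ Red  a b = cong (_+⋆ false) (sym (ℤ.+-assoc (+ 1) a b))

option-+ᵛʳ : ∀ A a b → option A (a ℤ.+ b +⋆ false) ≡ (a +⋆ false) +ᵛ option A (b +⋆ false)
option-+ᵛʳ Blue a b = cong (_+⋆ false) (sym (ℤ.+-pred a b))
option-+ᵛʳ Red  a b =
  cong (_+⋆ false) (solve 2 (λ a b → con (+ 1) :+ (a :+ b) := a :+ (con (+ 1) :+ b)) refl a b)
  where open +-*-Solver

option-step : ∀ A a → option A (a +⋆ false) ≤[ A ] a +⋆ true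
option-step Blue a = below (ℤ.i≤pred[j]⇒i<j ℤ.≤-refl)
option-step Red  a = below (ℤ.suc[i]≤j⇒i<j ℤ.≤-refl)

option-⋆ : ∀ A x → T (star x) → option A x ≡ x +ᵛ ⋆ᵛ
option-⋆ A (a +⋆ true) _ = cong (_+⋆ false) (sym (ℤ.+-identityʳ a))

option-+ᵛ : ∀ A x y → HasOption A (x +ᵛ y) →
  (HasOption A x × option A (x +ᵛ y) ≤[ A ] option A x +ᵛ y) ⊎
  (HasOption A y × option A (x +ᵛ y) ≤[ A ] x +ᵛ option A y)
option-+ᵛ A (a +⋆ false) (b +⋆ true)  _ = inj₂ (inj₁ tt , ≤[]-refl A)
option-+ᵛ A (a +⋆ true)  (b +⋆ false) _ = inj₁ (inj₁ tt , ≤[]-refl A)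
option-+ᵛ A (a +⋆ true)  (b +⋆ true)  _ = inj₂ (inj₁ tt , option-step A (a ℤ.+ b))
option-+ᵛ A (a +⋆ false) (b +⋆ false) (inj₁ ())
option-+ᵛ A (a +⋆ false) (b +⋆ false) (inj₂ h) with favours-+ A a b h
... | inj₁ fa = inj₁ (inj₂ fa , ≤[]-reflexive A (option-+ᵛˡ A a b))
... | inj₂ fb = inj₂ (inj₂ fb , ≤[]-reflexive A (option-+ᵛʳ A a b))

-- Games certified to equal such a value

-- G HasValue x certifies G = x by the simplicity conditions: no option of a player is at least as good as x for
-- that player, and some option is at least as good as x's canonical option for that player.
record Side (Cert : Game → Val → Set) (A : Player) (x : Val) {n : ℕ} (options : Fin n → Game) : Set where
  field
    value         : Fin n → Val
    certified     : ∀ i → Cert (options i) (value i)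
    worse         : ∀ i → ¬ (x ≤[ A ] value i)
    reachesOption : HasOption A x → Σ (Fin n) λ i → option A x ≤[ A ] value i

open Side

infix 2 _HasValue_

data _HasValue_ : Game → Val → Set where
  hasValue : ∀ {nl L nr R x} → Side _HasValue_ Blue x L → Side _HasValue_ Red x R → mk nl L nr R HasValue x

≰ᵛ-witness : ∀ {C x y m n} {L : Fin m → Game} {R : Fin n → Game}
  (sL : Side C Blue x L) (sR : Side C Red y R) → ¬ (x ≤ᵛ y) →
  (Σ (Fin m) λ i → y ≤ᵛ value sL i) ⊎ (Σ (Fin n) λ j → value sR j ≤ᵛ x)
≰ᵛ-witness {x = x} {y} sL sR x≰y with ≰ᵛ-option x y x≰y
... | inj₁ (o , y≤xᴸ) = let i , xᴸ≤v = reachesOption sL o in inj₁ (i , ≤ᵛ-trans y≤xᴸ xᴸ≤v)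
... | inj₂ (o , yᴿ≤x) = let j , v≤yᴿ = reachesOption sR o in inj₂ (j , ≤ᵛ-trans v≤yᴿ yᴿ≤x)

≤G-fromValue : ∀ {G H x y} → G HasValue x → H HasValue y → x ≤ᵛ y → G ≤G H
≤ᵛ-fromGame  : ∀ {G H x y} → G HasValue x → H HasValue y → G ≤G H → x ≤ᵛ y

≤G-fromValue gG@(hasValue sL _) hH@(hasValue _ sR) x≤y =
  (λ i H≤Gᴸ → worse sL i (≤ᵛ-trans x≤y (≤ᵛ-fromGame hH (certified sL i) H≤Gᴸ))) ,
  (λ j Hᴿ≤G → worse sR j (≤ᵛ-trans (≤ᵛ-fromGame (certified sR j) gG Hᴿ≤G) x≤y))

≤ᵛ-fromGame {x = x} {y} gG@(hasValue sL _) hH@(hasValue _ sR) (noL , noR) =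
  Dec.decidable-stable (x ≤ᵛ? y) λ x≰y →
    [ (λ l → noL (proj₁ l) (≤G-fromValue hH (certified sL (proj₁ l)) (proj₂ l))) ,
      (λ r → noR (proj₁ r) (≤G-fromValue (certified sR (proj₁ r)) gG (proj₂ r))) ]′
    (≰ᵛ-witness sL sR x≰y)

≈G-fromValue : ∀ {G H x} → G HasValue x → H HasValue x → G ≈G H
≈G-fromValue gG hH = ≤G-fromValue gG hH ≤ᵛ-refl , ≤G-fromValue hH gG ≤ᵛ-refl

⧺-pointwise : ∀ {m n} {A B : Set} (P : A → B → Set) {f : Fin m → A} {g : Fin n → A}
  {f′ : Fin m → B} {g′ : Fin n → B} → (∀ i → P (f i) (f′ i)) → (∀ j → P (g j) (g′ j)) →
  ∀ k → P ((f ⧺ g) k) ((f′ ⧺ g′) k)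
⧺-pointwise {m} P pf pg k with splitAt m k
... | inj₁ i = pf i
... | inj₂ j = pg j

Side-+ : ∀ {C A x y m n} {F F′ : Fin m → Game} {G G′ : Fin n → Game}
  (sF : Side C A x F) (sG : Side C A y G) →
  (∀ i → C (F′ i) (value sF i +ᵛ y)) → (∀ j → C (G′ j) (x +ᵛ value sG j)) →
  Side C A (x +ᵛ y) (F′ ⧺ G′)
Side-+ {C} {A} {x} {y} {m} {n} {F′ = F′} {G′ = G′} sF sG cF cG = record
  { value         = vF ⧺ vG
  ; certified     = ⧺-pointwise C cF cG
  ; worse         = ⧺-pointwise (λ _ v → ¬ (x +ᵛ y ≤[ A ] v)) {f = F′} {g = G′}
                      (λ i → worse sF i ∘ ≤[]-cancelʳ A y) (λ j → worse sG j ∘ ≤[]-cancelˡ A x)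
  ; reachesOption = reaches ∘ option-+ᵛ A x y
  }
  where
  vF = λ i → value sF i +ᵛ y
  vG = λ j → x +ᵛ value sG j
  reaches : (HasOption A x × option A (x +ᵛ y) ≤[ A ] option A x +ᵛ y) ⊎
            (HasOption A y × option A (x +ᵛ y) ≤[ A ] x +ᵛ option A y) →
            Σ (Fin (m ℕ.+ n)) λ k → option A (x +ᵛ y) ≤[ A ] (vF ⧺ vG) k
  reaches (inj₁ (ox , le)) = let i , le′ = reachesOption sF ox in
    i ↑ˡ n , subst (option A (x +ᵛ y) ≤[ A ]_) (sym (lookup-++ˡ vF vG i))
                   (≤[]-trans A le (≤[]-+ʳ A y le′))
  reaches (inj₂ (oy , le)) = let j , le′ = reachesOption sG oy in
    m ↑ʳ j , subst (option A (x +ᵛ y) ≤[ A ]_) (sym (lookup-++ʳ vF vG j))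
                   (≤[]-trans A le (≤[]-+ˡ A x le′))

hasValue-+ : ∀ {G H x y} → G HasValue x → H HasValue y → (G +G H) HasValue (x +ᵛ y)
hasValue-+ gG@(hasValue gL gR) hH@(hasValue hL hR) =
  hasValue (Side-+ gL hL (λ i → hasValue-+ (certified gL i) hH) (λ j → hasValue-+ gG (certified hL j)))
           (Side-+ gR hR (λ i → hasValue-+ (certified gR i) hH) (λ j → hasValue-+ gG (certified hR j)))

noOptions : ∀ {C A x} {F : Fin 0 → Game} → ¬ HasOption A x → Side C A x F
noOptions ¬o = record { value = λ () ; certified = λ () ; worse = λ () ; reachesOption = ⊥-elim ∘ ¬o }

oneOption : ∀ {C A x v G} → C G v → ¬ (x ≤[ A ] v) → option A x ≤[ A ] v → Side C A x {1} (λ _ → G)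
oneOption {v = v} c x≰v o≤v = record
  { value = λ _ → v ; certified = λ _ → c ; worse = λ _ → x≰v ; reachesOption = λ _ → zero , o≤v }

¬HasOption-0ᵛ : ∀ A → ¬ HasOption A 0ᵛ
¬HasOption-0ᵛ Blue (inj₂ (ℤ.+<+ ()))
¬HasOption-0ᵛ Red  (inj₂ (ℤ.+<+ ()))

hasValue-empty : ∀ {L R} → mk 0 L 0 R HasValue 0ᵛ
hasValue-empty = hasValue (noOptions (¬HasOption-0ᵛ Blue)) (noOptions (¬HasOption-0ᵛ Red))

hasValue-⋆ : ⋆G HasValue ⋆ᵛ
hasValue-⋆ = hasValue (oneOption hasValue-empty (Dec.from-no (⋆ᵛ ≤ᵛ? 0ᵛ)) ≤ᵛ-refl)
                      (oneOption hasValue-empty (Dec.from-no (0ᵛ ≤ᵛ? ⋆ᵛ)) ≤ᵛ-refl)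

hasValue-1 : 1G HasValue (+ 1 +⋆ false)
hasValue-1 = hasValue (oneOption hasValue-empty (Dec.from-no (+ 1 +⋆ false ≤ᵛ? 0ᵛ)) ≤ᵛ-refl)
                      (noOptions λ { (inj₂ (ℤ.+<+ ())) })

hasValue-neg1 : -G 1G HasValue (-[1+ 0 ] +⋆ false)
hasValue-neg1 = hasValue (noOptions λ { (inj₂ ()) })
                       (oneOption hasValue-empty (Dec.from-no (0ᵛ ≤ᵛ? -[1+ 0 ] +⋆ false)) ≤ᵛ-refl)

hasValue-× : ∀ m {G x} → G HasValue x → (m ×G G) HasValue (m ×ᵛ x)
hasValue-× ℕ.zero    _ = hasValue-empty
hasValue-× (ℕ.suc m) h = hasValue-+ h (hasValue-× m h)

-- Myopic Col on a directed path

Colouring : ℕ → Set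
Colouring k = Fin k → Colour

-- A missing successor behaves like an uncoloured one.
headColour : ∀ {k} → Colouring k → Colour
headColour {ℕ.zero}  c = uncoloured
headColour {ℕ.suc k} c = c zero

next : ∀ {k} → Colouring k → Fin k → Colour
next c zero    = headColour (c ∘ suc)
next c (suc v) = next (c ∘ suc) v

predUncoloured : ∀ {k} → Bool → Colouring k → Fin k → Bool
predUncoloured p c zero    = p
predUncoloured p c (suc v) = predUncoloured (isUncoloured (c zero)) (c ∘ suc) v

contribution : Bool → Colour → Val
contribution false _          = 0ᵛ
contribution true  uncoloured = ⋆ᵛ
contribution true  blue       = -[1+ 0 ] +⋆ false
contribution true  red        = + 1 +⋆ false

-- pathValueFrom p c: the sum of the contributions of the vertices of the path c, preceded by one more vertex
-- which is uncoloured iff p; each vertex is credited with the contribution of its predecessor.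
pathValueFrom : ∀ {k} → Bool → Colouring k → Val
pathValueFrom {ℕ.zero}  p c = contribution p uncoloured
pathValueFrom {ℕ.suc k} p c = contribution p (c zero) +ᵛ pathValueFrom (isUncoloured (c zero)) (c ∘ suc)

pathValue : ∀ {k} → Colouring k → Val
pathValue = pathValueFrom false

pathValueFrom-head : ∀ {k} p (c : Colouring k) →
  pathValueFrom p c ≡ contribution p (headColour c) +ᵛ pathValue c
pathValueFrom-head {ℕ.zero}  p c = sym (+ᵛ-identityʳ _)
pathValueFrom-head {ℕ.suc k} p c = cong (contribution p (c zero) +ᵛ_) (sym (+ᵛ-identityˡ _))

-- Colouring an uncoloured vertex with successor colour N removes its own contribution and, when its predecessor is
-- uncoloured (q), that predecessor's ⋆; the predecessor then contributes according to the new colour.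
removed : Bool → Colour → Val
removed q N = contribution q uncoloured +ᵛ contribution true N

pathValueFrom-recolour : ∀ {k} p (c : Colouring k) v x → c v ≡ uncoloured → isUncoloured x ≡ false →
  pathValueFrom p (recolour c v x) +ᵛ removed (predUncoloured p c v) (next c v)
  ≡ pathValueFrom p c +ᵛ contribution (predUncoloured p c v) x
pathValueFrom-recolour {ℕ.suc k} p c zero x cv hx rewrite cv | hx = begin
  (X +ᵛ R) +ᵛ (U +ᵛ N)                     ≡⟨ rearrange ⟩
  (U +ᵛ (N +ᵛ R)) +ᵛ X                     ≡⟨ cong (λ t → (U +ᵛ t) +ᵛ X) head ⟨
  (U +ᵛ pathValueFrom true (c ∘ suc)) +ᵛ X ∎
  where
  open MonoidSolver +ᵛ-0ᵛ-commutativeMonoid using (prove; var; _⊕_)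
  X = contribution p x
  R = pathValue (c ∘ suc)
  U = contribution p uncoloured
  N = contribution true (headColour (c ∘ suc))
  head = pathValueFrom-head true (c ∘ suc)
  rearrange : (X +ᵛ R) +ᵛ (U +ᵛ N) ≡ (U +ᵛ (N +ᵛ R)) +ᵛ X
  rearrange = prove 4 ((X′ ⊕ R′) ⊕ (U′ ⊕ N′)) ((U′ ⊕ (N′ ⊕ R′)) ⊕ X′) (X ∷ R ∷ U ∷ N ∷ [])
    where X′ = var zero ; R′ = var (suc zero) ; U′ = var (suc (suc zero)) ; N′ = var (suc (suc (suc zero)))
pathValueFrom-recolour {ℕ.suc k} p c (suc v) x cv hx = begin
  (C +ᵛ pathValueFrom q (recolour (c ∘ suc) v x)) +ᵛ K ≡⟨ +ᵛ-assoc C _ K ⟩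
  C +ᵛ (pathValueFrom q (recolour (c ∘ suc) v x) +ᵛ K) ≡⟨ cong (C +ᵛ_) (pathValueFrom-recolour q _ v x cv hx) ⟩
  C +ᵛ (pathValueFrom q (c ∘ suc) +ᵛ M)                ≡⟨ +ᵛ-assoc C _ M ⟨
  (C +ᵛ pathValueFrom q (c ∘ suc)) +ᵛ M                ∎
  where
  C = contribution p (c zero)
  q = isUncoloured (c zero)
  K = removed (predUncoloured q (c ∘ suc) v) (next (c ∘ suc) v)
  M = contribution (predUncoloured q (c ∘ suc) v) x

isUncoloured⇒≡ : ∀ {x} → isUncoloured x ≡ true → x ≡ uncoloured
isUncoloured⇒≡ {uncoloured} _ = refl

and-const-true : ∀ n → and (tabulate {n = n} (λ _ → true)) ≡ true
and-const-true ℕ.zero    = refl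
and-const-true (ℕ.suc n) = and-const-true n

-- On a path the only out-neighbour of v is its successor.
and-pathArc : ∀ {k} (c : Colouring k) A v →
  and (tabulate (λ b → not (pathArc k v b ∧ isColour A (c b)))) ≡ not (isColour A (next c v))
and-pathArc {ℕ.suc ℕ.zero}     c Blue zero = refl
and-pathArc {ℕ.suc ℕ.zero}     c Red  zero = refl
and-pathArc {ℕ.suc (ℕ.suc k)} c A zero
  rewrite and-const-true k = ∧-identityʳ (not (isColour A (c (suc zero))))
and-pathArc {ℕ.suc k}         c A (suc v) = and-pathArc (c ∘ suc) A v

legal-pathArc : ∀ {k} (c : Colouring k) A v →
  legal (pathArc k) c A v ≡ isUncoloured (c v) ∧ not (isColour A (next c v))
legal-pathArc {k} c A v = cong (isUncoloured (c v) ∧_) (trans (cong and (map-tabulate id unblocked)) (and-pathArc c A v))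
  where unblocked = λ b → not (pathArc k v b ∧ isColour A (c b))

legal-pathArc⁻ : ∀ {k} (c : Colouring k) A v → T (legal (pathArc k) c A v) →
  c v ≡ uncoloured × T (not (isColour A (next c v)))
legal-pathArc⁻ c A v l with Equivalence.to T-∧ (subst T (legal-pathArc c A v) l)
... | u , n = isUncoloured⇒≡ (Equivalence.to T-≡ u) , n

legal-pathArc⁺ : ∀ {k} (c : Colouring k) A v → c v ≡ uncoloured → T (not (isColour A (next c v))) →
  T (legal (pathArc k) c A v)
legal-pathArc⁺ c A v cv n =
  subst T (sym (legal-pathArc c A v)) (Equivalence.from T-∧ (subst (T ∘ isUncoloured) (sym cv) tt , n))

moves-legal : ∀ {k} arc (c : Fin k → Colour) A i → T (legal arc c A (lookup (moves arc c A) i))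
moves-legal {k} arc c A i = proj₂ (∈-filter⁻ (T? ∘ legal arc c A) {xs = allFin k} (∈-lookup i))

moves-complete : ∀ {k} arc (c : Fin k → Colour) A v → T (legal arc c A v) →
  Σ (Fin (length (moves arc c A))) λ i → lookup (moves arc c A) i ≡ v
moves-complete arc c A v l = index v∈ , sym (lookup-index v∈)
  where v∈ = ∈-filter⁺ (T? ∘ legal arc c A) (∈-allFin v) l

module _ {A : Set} (p q : A → Bool) (q⇒p : ∀ a → T (q a) → T (p a)) where

  length-filterᵇ-mono : ∀ xs → length (filterᵇ q xs) ≤ length (filterᵇ p xs)
  length-filterᵇ-mono []       = z≤n
  length-filterᵇ-mono (y ∷ ys) with q y in qy | p y in py
  ... | true  | true  = s≤s (length-filterᵇ-mono ys)
  ... | true  | false = ⊥-elim (subst T py (q⇒p y (subst T (sym qy) tt)))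
  ... | false | true  = ℕ.m≤n⇒m≤1+n (length-filterᵇ-mono ys)
  ... | false | false = length-filterᵇ-mono ys

  length-filterᵇ-< : ∀ {x} xs → x ∈ xs → T (p x) → ¬ T (q x) →
    length (filterᵇ q xs) < length (filterᵇ p xs)
  length-filterᵇ-< (y ∷ ys) (here refl) px ¬qx with q y | p y
  ... | true  | _     = ⊥-elim (¬qx tt)
  ... | false | false = ⊥-elim px
  ... | false | true  = s≤s (length-filterᵇ-mono ys)
  length-filterᵇ-< (y ∷ ys) (there x∈) px ¬qx with q y in qy | p y in py
  ... | true  | true  = s≤s (length-filterᵇ-< ys x∈ px ¬qx)
  ... | true  | false = ⊥-elim (subst T py (q⇒p y (subst T (sym qy) tt)))
  ... | false | true  = ℕ.m≤n⇒m≤1+n (length-filterᵇ-< ys x∈ px ¬qx)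
  ... | false | false = length-filterᵇ-< ys x∈ px ¬qx

countUncoloured-recolour : ∀ {k} (c : Colouring k) v x → c v ≡ uncoloured → isUncoloured x ≡ false →
  countUncoloured (recolour c v x) < countUncoloured c
countUncoloured-recolour {k} c v x cv hx =
  length-filterᵇ-< (isUncoloured ∘ c) (isUncoloured ∘ recolour c v x) stillUncoloured (allFin k) (∈-allFin v)
    (subst (T ∘ isUncoloured) (sym cv) tt) nowColoured
  where
  stillUncoloured : ∀ w → T (isUncoloured (recolour c v x w)) → T (isUncoloured (c w))
  stillUncoloured w u with does (w Fin.≟ v)
  ... | true  = ⊥-elim (subst T hx u)
  ... | false = u
  nowColoured : ¬ T (isUncoloured (recolour c v x v))
  nowColoured rewrite dec-true (v Fin.≟ v) refl | hx = id

pathValue-allColoured : ∀ {k} (c : Colouring k) → (∀ v → ¬ T (isUncoloured (c v))) → pathValue c ≡ 0ᵛ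
pathValue-allColoured {ℕ.zero}  c _ = refl
pathValue-allColoured {ℕ.suc k} c h with c zero in c₀
... | uncoloured = ⊥-elim (h zero (subst (T ∘ isUncoloured) (sym c₀) tt))
... | blue = trans (+ᵛ-identityˡ _) (pathValue-allColoured (c ∘ suc) (h ∘ suc))
... | red  = trans (+ᵛ-identityˡ _) (pathValue-allColoured (c ∘ suc) (h ∘ suc))

pathValue-noUncoloured : ∀ {k} (c : Colouring k) → countUncoloured c ≤ 0 → pathValue c ≡ 0ᵛ
pathValue-noUncoloured {k} c h = pathValue-allColoured c λ v u →
  ℕ.<-irrefl refl (ℕ.<-≤-trans (filter-some (T? ∘ isUncoloured ∘ c) (lose (∈-allFin v) u)) h)

opponent : Player → Player
opponent Blue = Red
opponent Red  = Blue

colourOf-coloured : ∀ A → isUncoloured (colourOf A) ≡ false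
colourOf-coloured Blue = refl
colourOf-coloured Red  = refl

uncoloured-legal : ∀ A → T (not (isColour A uncoloured))
uncoloured-legal Blue = tt
uncoloured-legal Red  = tt

opponent-legal : ∀ A → T (not (isColour A (colourOf (opponent A))))
opponent-legal Blue = tt
opponent-legal Red  = tt

step : Player → Val
step A = contribution true (colourOf A)

option-int : ∀ A x → ¬ T (star x) → option A x ≡ x +ᵛ step A
option-int A    (a +⋆ true)  ¬s = ⊥-elim (¬s tt)
option-int Blue (a +⋆ false) _  = cong (_+⋆ false) (ℤ.+-comm -[1+ 0 ] a)
option-int Red  (a +⋆ false) _  = cong (_+⋆ false) (ℤ.+-comm (+ 1) a)

pathValue-move : ∀ {k} (c : Colouring k) A v → c v ≡ uncoloured →
  pathValue (recolour c v (colourOf A)) +ᵛ removed (predUncoloured false c v) (next c v)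
  ≡ pathValue c +ᵛ contribution (predUncoloured false c v) (colourOf A)
pathValue-move c A v cv = pathValueFrom-recolour false c v (colourOf A) cv (colourOf-coloured A)

move-worse : ∀ A q N → T (not (isColour A N)) → ¬ (removed q N ≤[ A ] contribution q (colourOf A))
move-worse Blue false uncoloured _ = Dec.from-no (⋆ᵛ ≤ᵛ? 0ᵛ)
move-worse Blue false red        _ = Dec.from-no (+ 1 +⋆ false ≤ᵛ? 0ᵛ)
move-worse Blue true  uncoloured _ = Dec.from-no (0ᵛ ≤ᵛ? -[1+ 0 ] +⋆ false)
move-worse Blue true  red        _ = Dec.from-no (+ 1 +⋆ true ≤ᵛ? -[1+ 0 ] +⋆ false)
move-worse Red  false uncoloured _ = Dec.from-no (0ᵛ ≤ᵛ? ⋆ᵛ)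
move-worse Red  false blue       _ = Dec.from-no (0ᵛ ≤ᵛ? -[1+ 0 ] +⋆ false)
move-worse Red  true  uncoloured _ = Dec.from-no (+ 1 +⋆ false ≤ᵛ? 0ᵛ)
move-worse Red  true  blue       _ = Dec.from-no (+ 1 +⋆ false ≤ᵛ? -[1+ 0 ] +⋆ true)
move-worse Blue _     blue       ()
move-worse Red  _     red        ()

privateMove-step : ∀ A → step A +ᵛ removed false (colourOf (opponent A)) ≤[ A ] contribution false (colourOf A)
privateMove-step Blue = ≤ᵛ-refl
privateMove-step Red  = ≤ᵛ-refl

predecessorMove-step : ∀ A q → step A +ᵛ removed q uncoloured ≤[ A ] contribution q (colourOf A)
predecessorMove-step Blue false = Dec.from-yes (-[1+ 0 ] +⋆ true ≤ᵛ? 0ᵛ)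
predecessorMove-step Blue true  = ≤ᵛ-refl
predecessorMove-step Red  false = Dec.from-yes (0ᵛ ≤ᵛ? + 1 +⋆ true)
predecessorMove-step Red  true  = ≤ᵛ-refl

T-xor-¬ˡ : ∀ {a b} → ¬ T a → T (a xor b) → T b
T-xor-¬ˡ {false} _  t = t
T-xor-¬ˡ {true}  ¬a _ = ⊥-elim (¬a tt)

star-contribution : ∀ p col → T (star (contribution p col)) → p ≡ true × col ≡ uncoloured
star-contribution true uncoloured _ = refl , refl

favours-contribution : ∀ A p col → Favours A (int (contribution p col)) →
  p ≡ true × col ≡ colourOf (opponent A)
favours-contribution Blue false _          (ℤ.+<+ ())
favours-contribution Red  false _          (ℤ.+<+ ())
favours-contribution Blue true uncoloured  (ℤ.+<+ ())
favours-contribution Red  true uncoloured  (ℤ.+<+ ())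
favours-contribution Blue true blue        ()
favours-contribution Red  true red         (ℤ.+<+ ())
favours-contribution Blue true red         _ = refl , refl
favours-contribution Red  true blue        _ = refl , refl

starVertex : ∀ {k} p (c : Colouring k) → T (star (pathValueFrom p c)) →
  (Σ (Fin k) λ v → c v ≡ uncoloured × next c v ≡ uncoloured × predUncoloured p c v ≡ false) ⊎
  (p ≡ true × headColour c ≡ uncoloured)
starVertex {ℕ.zero}  p c s = inj₂ (star-contribution p uncoloured s)
starVertex {ℕ.suc k} p c s with T? (star (contribution p (c zero)))
... | yes s₀ = inj₂ (star-contribution p (c zero) s₀)
... | no ¬s₀ with starVertex _ (c ∘ suc) (T-xor-¬ˡ ¬s₀ (subst T (star-+ᵛ (contribution p (c zero)) _) s))
...   | inj₁ (v , cv , nv , pv) = inj₁ (suc v , cv , nv , pv)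
...   | inj₂ (u , n) with p
...     | false = inj₁ (zero , isUncoloured⇒≡ u , n , refl)
...     | true  = ⊥-elim (¬s₀ (subst (T ∘ star ∘ contribution true) (sym (isUncoloured⇒≡ u)) tt))

favourableVertex : ∀ A {k} p (c : Colouring k) → Favours A (int (pathValueFrom p c)) →
  (Σ (Fin k) λ v → c v ≡ uncoloured × next c v ≡ colourOf (opponent A)) ⊎
  (p ≡ true × headColour c ≡ colourOf (opponent A))
favourableVertex A {ℕ.zero}  p c f = inj₂ (favours-contribution A p uncoloured f)
favourableVertex A {ℕ.suc k} p c f with favours-+ A _ _ (subst (Favours A) (int-+ᵛ (contribution p (c zero)) _) f)
... | inj₁ f₀ = inj₂ (favours-contribution A p (c zero) f₀)
... | inj₂ f₁ with favourableVertex A (isUncoloured (c zero)) (c ∘ suc) f₁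
...   | inj₁ (v , cv , nv) = inj₁ (suc v , cv , nv)
...   | inj₂ (u , n)       = inj₁ (zero , isUncoloured⇒≡ u , n)

uncolouredPredecessor : ∀ {k} p (c : Colouring k) v → predUncoloured p c v ≡ true →
  (Σ (Fin k) λ w → c w ≡ uncoloured × next c w ≡ c v) ⊎ (p ≡ true × toℕ v ≡ 0)
uncolouredPredecessor p c zero    h = inj₂ (h , refl)
uncolouredPredecessor p c (suc v) h with uncolouredPredecessor (isUncoloured (c zero)) (c ∘ suc) v h
... | inj₁ (w , cw , nw) = inj₁ (suc w , cw , nw)
uncolouredPredecessor p c (suc zero) h | inj₂ (u , _) = inj₁ (zero , isUncoloured⇒≡ u , refl)
uncolouredPredecessor p c (suc (suc v)) h | inj₂ (_ , ())

GoodMove : Player → ∀ {k} → Colouring k → Set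
GoodMove A {k} c = Σ (Fin k) λ v →
  T (legal (pathArc k) c A v) × option A (pathValue c) ≤[ A ] pathValue (recolour c v (colourOf A))

goodMoveAt : ∀ A {k} (c : Colouring k) v {t} → c v ≡ uncoloured → T (not (isColour A (next c v))) →
  option A (pathValue c) ≡ pathValue c +ᵛ t →
  t +ᵛ removed (predUncoloured false c v) (next c v) ≤[ A ] contribution (predUncoloured false c v) (colourOf A) →
  GoodMove A c
goodMoveAt A c v cv n o≡ le =
  v , legal-pathArc⁺ c A v cv n ,
  subst (_≤[ A ] pathValue (recolour c v (colourOf A))) (sym o≡) (≤[]-shift-better A (pathValue-move c A v cv) le)

goodMove-⋆ : ∀ A {k} (c : Colouring k) → T (star (pathValue c)) → GoodMove A c
goodMove-⋆ A c s with starVertex false c s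
... | inj₁ (v , cv , nv , pv) =
  goodMoveAt A c v cv (subst (T ∘ not ∘ isColour A) (sym nv) (uncoloured-legal A)) (option-⋆ A _ s)
    (subst₂ (λ q N → ⋆ᵛ +ᵛ removed q N ≤[ A ] contribution q (colourOf A)) (sym pv) (sym nv) (≤[]-refl A))
... | inj₂ (() , _)

goodMove-int : ∀ A {k} (c : Colouring k) → ¬ T (star (pathValue c)) → Favours A (int (pathValue c)) →
  GoodMove A c
goodMove-int A c ¬s f with favourableVertex A false c f
... | inj₁ (v , cv , nv) with predUncoloured false c v in pv
...   | false =
  goodMoveAt A c v cv (subst (T ∘ not ∘ isColour A) (sym nv) (opponent-legal A)) (option-int A _ ¬s)
    (subst₂ (λ q N → step A +ᵛ removed q N ≤[ A ] contribution q (colourOf A))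
            (sym pv) (sym nv) (privateMove-step A))
...   | true with uncolouredPredecessor false c v pv
...     | inj₁ (w , cw , nw) =
  goodMoveAt A c w cw (subst (T ∘ not ∘ isColour A) (sym nw′) (uncoloured-legal A)) (option-int A _ ¬s)
    (subst (λ N → step A +ᵛ removed q N ≤[ A ] contribution q (colourOf A))
           (sym nw′) (predecessorMove-step A q))
  where
  nw′ = trans nw cv
  q = predUncoloured false c w
...     | inj₂ (() , _)
goodMove-int A c ¬s f | inj₂ (() , _)

goodMove : ∀ A {k} (c : Colouring k) → HasOption A (pathValue c) → GoodMove A c
goodMove A c o with T? (star (pathValue c))
... | yes s = goodMove-⋆ A c s
... | no ¬s = goodMove-int A c ¬s ([ ⊥-elim ∘ ¬s , id ]′ o)

playMove : ∀ A {k} (c : Colouring k) → Fin (length (moves (pathArc k) c A)) → Colouring k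
playMove A {k} c i = recolour c (lookup (moves (pathArc k) c A) i) (colourOf A)

colGame'-side : ∀ A {k} f (c : Colouring k) → countUncoloured c ≤ ℕ.suc f →
  (∀ (c′ : Colouring k) → countUncoloured c′ ≤ f → colGame' f (pathArc k) c′ HasValue pathValue c′) →
  Side _HasValue_ A (pathValue c) (λ i → colGame' f (pathArc k) (playMove A c i))
colGame'-side A {k} f c count rec = record
  { value         = λ i → pathValue (playMove A c i)
  ; certified     = λ i → rec _ (ℕ.≤-pred (ℕ.≤-trans (fewer i) count))
  ; worse         = λ i → ≤[]-shift-worse A (pathValue-move c A (move i) (proj₁ (legal-move i)))
                                             (move-worse A _ _ (proj₂ (legal-move i)))
  ; reachesOption = reaches
  }
  where
  move = lookup (moves (pathArc k) c A)
  legal-move = λ i → legal-pathArc⁻ c A (move i) (moves-legal (pathArc k) c A i)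
  fewer : ∀ i → countUncoloured (playMove A c i) < countUncoloured c
  fewer i = countUncoloured-recolour c (move i) (colourOf A) (proj₁ (legal-move i)) (colourOf-coloured A)
  reaches : HasOption A (pathValue c) → Σ _ λ i → option A (pathValue c) ≤[ A ] pathValue (playMove A c i)
  reaches o with goodMove A c o
  ... | v , l , better with moves-complete (pathArc k) c A v l
  ...   | i , refl = i , better

colGame'-pathArc : ∀ {k} f (c : Colouring k) → countUncoloured c ≤ f → colGame' f (pathArc k) c HasValue pathValue c
colGame'-pathArc ℕ.zero    c count rewrite pathValue-noUncoloured c count = hasValue-empty
colGame'-pathArc (ℕ.suc f) c count =
  hasValue (colGame'-side Blue f c count (colGame'-pathArc f)) (colGame'-side Red f c count (colGame'-pathArc f))

colGame-pathArc : ∀ {k} (c : Colouring k) → colGame (pos k (pathArc k) c) HasValue pathValue c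
colGame-pathArc c = colGame'-pathArc (countUncoloured c) c ℕ.≤-refl

pathValueFrom-uncoloured : ∀ m → pathValueFrom true (λ (_ : Fin m) → uncoloured) ≡ ℕ.suc m ×ᵛ ⋆ᵛ
pathValueFrom-uncoloured ℕ.zero    = refl
pathValueFrom-uncoloured (ℕ.suc m) = cong (⋆ᵛ +ᵛ_) (pathValueFrom-uncoloured m)

pathValue-uncoloured : ∀ n → pathValue (λ (_ : Fin n) → uncoloured) ≡ n ×ᵛ ⋆ᵛ
pathValue-uncoloured ℕ.zero    = refl
pathValue-uncoloured (ℕ.suc n) = trans (+ᵛ-identityˡ _) (pathValueFrom-uncoloured n)

endColoured : Player → ∀ n → Colouring (ℕ.suc n)
endColoured A n w = if does (w Fin.≟ Fin.fromℕ n) then colourOf A else uncoloured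

pathValueFrom-endColoured : ∀ A m → pathValueFrom true (endColoured A m) ≡ m ×ᵛ ⋆ᵛ +ᵛ step A
pathValueFrom-endColoured Blue ℕ.zero    = refl
pathValueFrom-endColoured Red  ℕ.zero    = refl
pathValueFrom-endColoured A    (ℕ.suc m) =
  trans (cong (⋆ᵛ +ᵛ_) (pathValueFrom-endColoured A m)) (sym (+ᵛ-assoc ⋆ᵛ (m ×ᵛ ⋆ᵛ) _))

pathValue-endColoured : ∀ A m → pathValue (endColoured A (ℕ.suc m)) ≡ m ×ᵛ ⋆ᵛ +ᵛ step A
pathValue-endColoured A m = trans (+ᵛ-identityˡ _) (pathValueFrom-endColoured A m)

mainTheorem10 : (n : ℕ) → 1 ≤ n →
    (colGame (pathPos n) ≈G n ×G ⋆G) ×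
    (colGame (pathPlusPos n Blue) ≈G (n ∸ 1) ×G ⋆G +G -G 1G) ×
    (colGame (pathPlusPos n Red) ≈G (n ∸ 1) ×G ⋆G +G 1G)
mainTheorem10 (ℕ.suc m) _ =
  ≈G-fromValue (valued (λ (_ : Fin (ℕ.suc m)) → uncoloured) (pathValue-uncoloured (ℕ.suc m)))
               (hasValue-× (ℕ.suc m) hasValue-⋆) ,
  ≈G-fromValue (valued (endColoured Blue (ℕ.suc m)) (pathValue-endColoured Blue m))
               (hasValue-+ (hasValue-× m hasValue-⋆) hasValue-neg1) ,
  ≈G-fromValue (valued (endColoured Red (ℕ.suc m)) (pathValue-endColoured Red m))
               (hasValue-+ (hasValue-× m hasValue-⋆) hasValue-1)
  where
  valued : ∀ {k} (c : Colouring k) {x} → pathValue c ≡ x → colGame (pos k (pathArc k) c) HasValue x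
  valued c eq = subst (_ HasValue_) eq (colGame-pathArc c)
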